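{- Let $F$ be a finite field and let $E_1,E_2\subset F$ with $|E_1||E_2|>6|F|$. Then there exist $u,y\in F$, $y\neq0$, such that $u+y\in E_1$ and $uy\in E_2$. More precisely, for each nonnegative integer $s<\min(|E_1|,|E_2|)$ there is a set $D\subset F^*$ with $$|D|\geq\frac{|E_1||E_2||F^*|/|F|-\sqrt{6|E_1||E_2||F^*|}-s|F^*|}{\min(|E_1|,|E_2|)-s}$$ such that for each $u\in D$ there are at least $s$ elements $y\in F$ with $u+y\in E_1$ and $uy\in E_2$.
   Context: $F^*=F\setminus\{0\}$. -}

module Defs where

open import Level using (0ℓ)
open import Data.Nat using (ℕ; _+_; _*_; _∸_; _≤_; _⊓_)
open import Data.Fin using (Fin)
open import Data.Product using (∃)
open import Relation.Binary.PropositionalEquality using (_≡_; _≢_)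
open import Algebra.Structures using (IsCommutativeRing)

-- A finite field, presented (up to isomorphism) with carrier Fin q and
-- propositional equality: a commutative ring with 0 ≠ 1 in which every
-- nonzero element has a multiplicative inverse.
record FiniteField : Set where
  field
    q     : ℕ
    _+F_  : Fin q → Fin q → Fin q
    _*F_  : Fin q → Fin q → Fin q
    -F_   : Fin q → Fin q
    0F 1F : Fin q
    isCommutativeRing : IsCommutativeRing {A = Fin q} _≡_ _+F_ _*F_ -F_ 0F 1F
    0≢1   : 0F ≢ 1F
    inverse : ∀ x → x ≢ 0F → ∃ λ y → x *F y ≡ 1F

-- The bound of Theorem 5.3, cleared of denominators and of the square root.
-- With a = |E1|, b = |E2|, m = min(a,b), d = |D|, q = |F|, q* = |F*| = q - 1,
-- and m - s > 0, the inequality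
--   d ≥ (a b q*/q - sqrt(6 a b q*) - s q*) / (m - s)
-- is equivalent (multiply by (m-s) q > 0) to
--   T ≤ q * sqrt(6 a b q*)   where  T = a b q* - d (m-s) q - s q* q,
-- i.e. to  max(T,0)^2 ≤ 6 a b q* q^2 ;  max(T,0) is computed with truncated ∸.
Bound53 : (q a b s d : ℕ) → Set
Bound53 q a b s d =
  let qs = q ∸ 1
      m  = a ⊓ b
      T⁺ = (a * b * qs) ∸ (d * (m ∸ s) * q + s * qs * q)
  in T⁺ * T⁺ ≤ 6 * a * b * qs * (q * q)

module Submission where

-- Let N be the number of pairs (u, y) with u ≠ 0, u + y ∈ E₁ and u y ∈ E₂.  Substituting
-- x = u + y gives N = Σ_{z ∈ E₂} R z, where R z counts the pairs (x, u) with x ∈ E₁, u ≠ 0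
-- and u (x - u) = z.  The first moment is Σ R = |E₁| (q - 1).  For the second moment, two
-- such pairs (x, v + w) and (x', v) collide only through a linear equation in v, which has
-- at most one solution unless w = 0 and x = x', or w = x and x' = -x; hence
-- Σ R² ≤ (q - 1) |E₁|² + 2 q |E₁|.  Cauchy–Schwarz for Σ_{z ∈ E₂} (q R z - |E₁| (q - 1)) gives
--   (q N - |E₁| |E₂| (q - 1))² ≤ |E₂| (q (q - 1) |E₁|² + 2 q³ |E₁|),
-- which forces N > 0 as soon as |E₁| |E₂| > 6 q.  For the second claim, each u ≠ 0 has at most
-- min(|E₁|, |E₂|) admissible y, so N ≤ |D| (min(|E₁|, |E₂|) - s) + s (q - 1); combined with the
-- inequality above this is the bound on |D| with denominators and the square root cleared.

open import Defs
open import Data.Fin using (Fin)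
open import Data.Fin.Subset using (Subset; _∈_; ∣_∣)
open import Data.Product using (_×_; ∃; Σ; _,_; proj₁; proj₂)
open import Relation.Binary.PropositionalEquality using (_≢_)

module IntegerLemmas where

  open import Data.Integer using (ℤ; +_; -[1+_]; _+_; _*_; _-_; _≤_; 0ℤ; +≤+; nonNegative)
  open import Data.Integer.Properties
  open import Data.Nat as ℕ using (ℕ; z≤n; _∸_)
  import Data.Nat.Properties as ℕ
  open import Relation.Binary.PropositionalEquality

  *-monoˡ-≤-0≤ : ∀ {c a b} → 0ℤ ≤ c → a ≤ b → c * a ≤ c * b
  *-monoˡ-≤-0≤ {c} 0≤c = *-monoˡ-≤-nonNeg c {{nonNegative 0≤c}}

  *-nonNeg : ∀ {i j} → 0ℤ ≤ i → 0ℤ ≤ j → 0ℤ ≤ i * j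
  *-nonNeg {j = j} 0≤i 0≤j = *-monoʳ-≤-nonNeg j {{nonNegative 0≤j}} 0≤i

  x*x-nonNeg : ∀ x → 0ℤ ≤ x * x
  x*x-nonNeg (+ n)     = *-nonNeg {+ n} (+≤+ z≤n) (+≤+ z≤n)
  x*x-nonNeg -[1+ n ]  = +≤+ z≤n

  0≤+ : ∀ n → 0ℤ ≤ + n
  0≤+ n = +≤+ z≤n

  +[m∸n]≡+m-+n : ∀ {m n} → n ℕ.≤ m → + (m ∸ n) ≡ + m - + n
  +[m∸n]≡+m-+n {m} {n} n≤m = sym (trans (m-n≡m⊖n m n) (⊖-≥ n≤m))

  +n≡+m++[n∸m] : ∀ {m n} → m ℕ.≤ n → + n ≡ + m + + (n ∸ m)
  +n≡+m++[n∸m] m≤n = cong +_ (sym (ℕ.m+[n∸m]≡n m≤n))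

  +-nonNeg : ∀ {i j} → 0ℤ ≤ i → 0ℤ ≤ j → 0ℤ ≤ i + j
  +-nonNeg = +-mono-≤

  square-mono-≤ : ∀ {x y} → 0ℤ ≤ x → x ≤ y → x * x ≤ y * y
  square-mono-≤ {x} {y} 0≤x x≤y =
    ≤-trans (*-monoˡ-≤-0≤ 0≤x x≤y) (≤-trans (≤-reflexive (*-comm x y)) (*-monoˡ-≤-0≤ (≤-trans 0≤x x≤y) x≤y))

  i≤i+nonNeg : ∀ {i j} → 0ℤ ≤ j → i ≤ i + j
  i≤i+nonNeg {i} {j} 0≤j = i≤i+j i j {{nonNegative 0≤j}}

  i≤nonNeg+i : ∀ {i j} → 0ℤ ≤ j → i ≤ j + i
  i≤nonNeg+i {i} {j} 0≤j = i≤j+i i j {{nonNegative 0≤j}}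

module FiniteSums where

  open import Level using (Level)
  open import Data.Bool using (Bool; true; false; _∧_; not)
  open import Data.Fin using (Fin; zero; suc)
  open import Data.Fin.Permutation using (permutation)
  open import Data.Fin.Properties using (_≟_; 0≢1+n; suc-injective)
  open import Data.Integer using (ℤ; +_; _+_; _*_; -_; _-_; _≤_; _<_; 0ℤ; 1ℤ; +≤+; +<+)
  open import Data.Integer.Properties hiding (_≟_)
  open import Data.Integer.Tactic.RingSolver using (solve-∀)
  open import Data.Nat using (ℕ; zero; suc; z≤n; s≤s)
  open import Data.Vec using ([]; _∷_; lookup; tabulate)
  open import Data.Vec.Properties using (lookup∘tabulate; []=⇒lookup)
  open import Function using (_∘_)
  open import Relation.Binary.PropositionalEquality
  open import Relation.Nullary using (does; ¬_; yes; no)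
  open import Relation.Nullary.Decidable using (dec-true; dec-false)
  open import Relation.Unary using (Pred; Decidable)
  open import Algebra.Properties.Semiring.Sum +-*-semiring public
    using (sum; sum-syntax; ∑-distrib-+; ∑-comm; *-distribˡ-sum; *-distribʳ-sum; sum-cong-≗)
  open import Algebra.Properties.Semiring.Sum +-*-semiring using (sum-permute; sum-replicate-zero)
  open IntegerLemmas

  private variable
    ℓ : Level
    m n : ℕ

  ∑-mono-≤ : {f g : Fin n → ℤ} → (∀ i → f i ≤ g i) → sum f ≤ sum g
  ∑-mono-≤ {zero}  _   = ≤-refl
  ∑-mono-≤ {suc n} f≤g = +-mono-≤ (f≤g zero) (∑-mono-≤ (f≤g ∘ suc))

  ∑-nonNeg : {f : Fin n → ℤ} → (∀ i → 0ℤ ≤ f i) → 0ℤ ≤ sum f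
  ∑-nonNeg {zero}  _    = ≤-refl
  ∑-nonNeg {suc n} 0≤f = +-mono-≤ (0≤f zero) (∑-nonNeg (0≤f ∘ suc))

  ∑-const : ∀ n c → ∑[ i < n ] c ≡ + n * c
  ∑-const zero    c = refl
  ∑-const (suc n) c = trans (cong (_+_ c) (∑-const n c)) (sym (suc-* (+ n) c))

  ∑-pos⇒∃-pos : {f : Fin n → ℤ} → 0ℤ < sum f → ∃ λ i → 0ℤ < f i
  ∑-pos⇒∃-pos {zero}  (+<+ ())
  ∑-pos⇒∃-pos {suc n} {f} 0<∑ with 0ℤ <? f zero
  ... | yes 0<f₀ = zero , 0<f₀
  ... | no  0≮f₀ with ∑-pos⇒∃-pos {f = f ∘ suc}
                        (<-≤-trans 0<∑ (≤-trans (+-monoˡ-≤ _ (≮⇒≥ 0≮f₀)) (≤-reflexive (+-identityˡ _))))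
  ...   | i , 0<fᵢ = suc i , 0<fᵢ

  ∑-reindex : (σ σ⁻¹ : Fin n → Fin n) → (∀ i → σ (σ⁻¹ i) ≡ i) → (∀ i → σ⁻¹ (σ i) ≡ i) →
              (f : Fin n → ℤ) → ∑[ i < n ] f (σ i) ≡ sum f
  ∑-reindex σ σ⁻¹ inv₁ inv₂ f = sym (sum-permute f (permutation σ σ⁻¹ inv₁ inv₂))

  ∑-distrib-+₃ : (f g h : Fin n → ℤ) → ∑[ i < n ] (f i + g i + h i) ≡ sum f + sum g + sum h
  ∑-distrib-+₃ f g h = trans (∑-distrib-+ (λ i → f i + g i) h) (cong (_+ sum h) (∑-distrib-+ f g))

  ∑∑-distrib-+ : (f g : Fin m → Fin n → ℤ) →
                 ∑[ i < m ] ∑[ j < n ] (f i j + g i j) ≡ ∑[ i < m ] ∑[ j < n ] f i j + ∑[ i < m ] ∑[ j < n ] g i j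
  ∑∑-distrib-+ {n = n} f g =
    trans (sum-cong-≗ (λ i → ∑-distrib-+ (f i) (g i))) (∑-distrib-+ (λ i → ∑[ j < n ] f i j) (λ i → ∑[ j < n ] g i j))

  ∑∑-* : (f : Fin m → ℤ) (g : Fin n → ℤ) → ∑[ i < m ] ∑[ j < n ] (f i * g j) ≡ sum f * sum g
  ∑∑-* f g = trans (sum-cong-≗ (λ i → sym (*-distribˡ-sum (f i) g))) (sym (*-distribʳ-sum (sum g) f))

  ∑-*-∑-comm : (a : Fin m → ℤ) (b : Fin n → ℤ) (c : Fin m → Fin n → ℤ) →
               ∑[ i < m ] (a i * ∑[ j < n ] (b j * c i j)) ≡ ∑[ j < n ] (b j * ∑[ i < m ] (a i * c i j))
  ∑-*-∑-comm {m} {n} a b c = begin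
    ∑[ i < m ] (a i * ∑[ j < n ] (b j * c i j))
      ≡⟨ sum-cong-≗ (λ i → *-distribˡ-sum (a i) (λ j → b j * c i j)) ⟩
    ∑[ i < m ] ∑[ j < n ] (a i * (b j * c i j))
      ≡⟨ sum-cong-≗ (λ i → sum-cong-≗ (λ j → exchange (a i) (b j) (c i j))) ⟩
    ∑[ i < m ] ∑[ j < n ] (b j * (a i * c i j))
      ≡⟨ ∑-comm (λ i j → b j * (a i * c i j)) ⟩
    ∑[ j < n ] ∑[ i < m ] (b j * (a i * c i j))
      ≡⟨ sum-cong-≗ (λ j → *-distribˡ-sum (b j) (λ i → a i * c i j)) ⟨
    ∑[ j < n ] (b j * ∑[ i < m ] (a i * c i j)) ∎
    where
    open ≡-Reasoning
    exchange : ∀ x y z → x * (y * z) ≡ y * (x * z)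
    exchange = solve-∀

  -- Lagrange's identity: the double sum of e i * e j * (X i - X j)² is twice the Cauchy–Schwarz defect.
  cauchy-schwarz : (e X : Fin n → ℤ) → (∀ i → 0ℤ ≤ e i) →
                   ∑[ i < n ] (e i * X i) * ∑[ i < n ] (e i * X i) ≤ sum e * ∑[ i < n ] (e i * (X i * X i))
  cauchy-schwarz {n} e X 0≤e = 0≤i-j⇒j≤i (*-cancelˡ-≤-pos 0ℤ _ (+ 2) (subst (0ℤ ≤_) lagrange 0≤∑∑))
    where
    C A : Fin n → ℤ
    C i = e i * X i
    A i = e i * (X i * X i)
    E = sum e
    SC = sum C
    SA = sum A
    0≤∑∑ : 0ℤ ≤ ∑[ i < n ] ∑[ j < n ] (e i * e j * ((X i - X j) * (X i - X j)))
    0≤∑∑ = ∑-nonNeg (λ i → ∑-nonNeg (λ j → *-nonNeg (*-nonNeg (0≤e i) (0≤e j)) (x*x-nonNeg (X i - X j))))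
    expand : ∀ ei ej xi xj → ei * ej * ((xi - xj) * (xi - xj)) ≡
             ei * (xi * xi) * ej + ei * (ej * (xj * xj)) + - (+ 2) * (ei * xi) * (ej * xj)
    expand = solve-∀
    collect : ∀ E SA SC → SA * E + E * SA + - (+ 2) * SC * SC ≡ + 2 * (E * SA - SC * SC)
    collect = solve-∀
    lagrange : ∑[ i < n ] ∑[ j < n ] (e i * e j * ((X i - X j) * (X i - X j))) ≡ + 2 * (E * SA - SC * SC)
    lagrange = begin
      ∑[ i < n ] ∑[ j < n ] (e i * e j * ((X i - X j) * (X i - X j)))
        ≡⟨ sum-cong-≗ (λ i → sum-cong-≗ (λ j → expand (e i) (e j) (X i) (X j))) ⟩
      ∑[ i < n ] ∑[ j < n ] (A i * e j + e i * A j + - (+ 2) * C i * C j)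
        ≡⟨ ∑∑-distrib-+ (λ i j → A i * e j + e i * A j) (λ i j → - (+ 2) * C i * C j) ⟩
      ∑[ i < n ] ∑[ j < n ] (A i * e j + e i * A j) + ∑[ i < n ] ∑[ j < n ] (- (+ 2) * C i * C j)
        ≡⟨ cong₂ _+_ (trans (∑∑-distrib-+ (λ i j → A i * e j) (λ i j → e i * A j)) (cong₂ _+_ (∑∑-* A e) (∑∑-* e A)))
                     (∑∑-* (λ i → - (+ 2) * C i) C) ⟩
      SA * E + E * SA + ∑[ i < n ] (- (+ 2) * C i) * SC
        ≡⟨ cong (λ t → SA * E + E * SA + t * SC) (sym (*-distribˡ-sum (- (+ 2)) C)) ⟩
      SA * E + E * SA + - (+ 2) * SC * SC
        ≡⟨ collect E SA SC ⟩
      + 2 * (E * SA - SC * SC) ∎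
      where open ≡-Reasoning

  𝟙 : Bool → ℤ
  𝟙 true  = 1ℤ
  𝟙 false = 0ℤ

  𝟙-nonNeg : ∀ b → 0ℤ ≤ 𝟙 b
  𝟙-nonNeg true  = +≤+ z≤n
  𝟙-nonNeg false = +≤+ z≤n

  𝟙-≤1 : ∀ b → 𝟙 b ≤ 1ℤ
  𝟙-≤1 true  = +≤+ (s≤s z≤n)
  𝟙-≤1 false = +≤+ z≤n

  𝟙-not+𝟙 : ∀ b → 𝟙 (not b) + 𝟙 b ≡ 1ℤ
  𝟙-not+𝟙 true  = refl
  𝟙-not+𝟙 false = refl

  𝟙-*-≤ : ∀ b {t} → 0ℤ ≤ t → 𝟙 b * t ≤ t
  𝟙-*-≤ true  {t} _   = ≤-reflexive (*-identityˡ t)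
  𝟙-*-≤ false     0≤t = 0≤t

  *-𝟙-≤ : ∀ b {t} → 0ℤ ≤ t → t * 𝟙 b ≤ t
  *-𝟙-≤ b {t} 0≤t = ≤-trans (≤-reflexive (*-comm t (𝟙 b))) (𝟙-*-≤ b 0≤t)

  𝟙-∧ : ∀ a b → 𝟙 (a ∧ b) ≡ 𝟙 a * 𝟙 b
  𝟙-∧ true  b = sym (*-identityˡ (𝟙 b))
  𝟙-∧ false b = refl

  𝟙*𝟙-pos : ∀ a b → 0ℤ < 𝟙 a * 𝟙 b → a ≡ true × b ≡ true
  𝟙*𝟙-pos true  true  _         = refl , refl
  𝟙*𝟙-pos true  false (+<+ ())
  𝟙*𝟙-pos false _     (+<+ ())

  δ : Fin n → Fin n → ℤ
  δ i j = 𝟙 (does (i ≟ j))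

  δ-nonNeg : (i j : Fin n) → 0ℤ ≤ δ i j
  δ-nonNeg i j = 𝟙-nonNeg (does (i ≟ j))

  δ-≡ : {i j : Fin n} → i ≡ j → δ i j ≡ 1ℤ
  δ-≡ {i = i} {j} i≡j = cong 𝟙 (dec-true (i ≟ j) i≡j)

  δ-≢ : {i j : Fin n} → ¬ i ≡ j → δ i j ≡ 0ℤ
  δ-≢ {i = i} {j} i≢j = cong 𝟙 (dec-false (i ≟ j) i≢j)

  δ-sym : (i j : Fin n) → δ i j ≡ δ j i
  δ-sym i j with i ≟ j
  ... | yes i≡j = sym (δ-≡ (sym i≡j))
  ... | no  i≢j = sym (δ-≢ (i≢j ∘ sym))

  δ-≤-δ*δ : {i j : Fin n} {k l k′ l′ : Fin m} → (i ≡ j → k ≡ l × k′ ≡ l′) → δ i j ≤ δ k l * δ k′ l′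
  δ-≤-δ*δ {i = i} {j} {k} {l} {k′} {l′} implies with i ≟ j
  ... | no  _   = *-nonNeg (δ-nonNeg k l) (δ-nonNeg k′ l′)
  ... | yes i≡j = ≤-reflexive (sym (cong₂ _*_ (δ-≡ (proj₁ (implies i≡j))) (δ-≡ (proj₂ (implies i≡j)))))

  ∑-δ : (i : Fin n) (f : Fin n → ℤ) → ∑[ j < n ] (δ i j * f j) ≡ f i
  ∑-δ {suc n} zero    f = begin
    1ℤ * f zero + ∑[ j < n ] (0ℤ * f (suc j))
      ≡⟨ cong₂ _+_ (*-identityˡ (f zero)) (sum-cong-≗ (*-zeroˡ ∘ f ∘ suc)) ⟩
    f zero + ∑[ j < n ] 0ℤ
      ≡⟨ cong (_+_ (f zero)) (sum-replicate-zero n) ⟩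
    f zero + 0ℤ
      ≡⟨ +-identityʳ (f zero) ⟩
    f zero ∎
    where open ≡-Reasoning
  ∑-δ {suc n} (suc i) f = begin
    0ℤ * f zero + ∑[ j < n ] (δ i j * f (suc j))  ≡⟨ cong (_+ ∑[ j < n ] (δ i j * f (suc j))) (*-zeroˡ (f zero)) ⟩
    0ℤ + ∑[ j < n ] (δ i j * f (suc j))           ≡⟨ +-identityˡ _ ⟩
    ∑[ j < n ] (δ i j * f (suc j))                ≡⟨ ∑-δ i (f ∘ suc) ⟩
    f (suc i)                                     ∎
    where open ≡-Reasoning

  ∑-δ′ : (i : Fin n) (f : Fin n → ℤ) → ∑[ j < n ] (δ j i * f j) ≡ f i
  ∑-δ′ i f = trans (sum-cong-≗ (λ j → cong (_* f j) (δ-sym j i))) (∑-δ i f)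

  ∑-δ-unique≤1 : (f h : Fin n → Fin m) → (∀ {i j} → f i ≡ h i → f j ≡ h j → i ≡ j) →
                 ∑[ i < n ] δ (f i) (h i) ≤ 1ℤ
  ∑-δ-unique≤1 {zero}  f h unique = +≤+ z≤n
  ∑-δ-unique≤1 {suc n} f h unique with f zero ≟ h zero
  ... | yes e₀ = ≤-reflexive (cong (_+_ 1ℤ) (trans (sum-cong-≗ others≡0) (sum-replicate-zero n)))
    where
    others≡0 : ∀ j → δ (f (suc j)) (h (suc j)) ≡ 0ℤ
    others≡0 j = δ-≢ (λ eⱼ → 0≢1+n (unique e₀ eⱼ))
  ... | no  _  = ≤-trans (≤-reflexive (+-identityˡ _))
                         (∑-δ-unique≤1 (f ∘ suc) (h ∘ suc) (λ eᵢ eⱼ → suc-injective (unique eᵢ eⱼ)))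

  pushforward : (Fin m → ℤ) → (Fin m → Fin n) → Fin n → ℤ
  pushforward a f z = ∑[ i < _ ] (a i * δ (f i) z)

  ∑-*-pushforward : (b : Fin n → ℤ) (a : Fin m → ℤ) (f : Fin m → Fin n) →
                    ∑[ z < n ] (b z * pushforward a f z) ≡ ∑[ i < m ] (a i * b (f i))
  ∑-*-pushforward b a f = trans (∑-*-∑-comm b a (λ z i → δ (f i) z)) (sum-cong-≗ (λ i → cong (a i *_) (
    trans (sum-cong-≗ (λ z → *-comm (b z) (δ (f i) z))) (∑-δ (f i) b))))

  ∣p∣≡∑𝟙 : (p : Subset n) → + ∣ p ∣ ≡ ∑[ i < n ] 𝟙 (lookup p i)
  ∣p∣≡∑𝟙 []          = refl
  ∣p∣≡∑𝟙 (true ∷ p)  = cong (_+_ 1ℤ) (∣p∣≡∑𝟙 p)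
  ∣p∣≡∑𝟙 (false ∷ p) = trans (∣p∣≡∑𝟙 p) (sym (+-identityˡ _))

  ∣tabulate∣≡∑𝟙 : (f : Fin n → Bool) → + ∣ tabulate f ∣ ≡ ∑[ i < n ] 𝟙 (f i)
  ∣tabulate∣≡∑𝟙 f = trans (∣p∣≡∑𝟙 (tabulate f)) (sum-cong-≗ (cong 𝟙 ∘ lookup∘tabulate f))

  ∈-tabulate⁻ : {f : Fin n → Bool} {i : Fin n} → i ∈ tabulate f → f i ≡ true
  ∈-tabulate⁻ {f = f} {i} i∈ = trans (sym (lookup∘tabulate f i)) ([]=⇒lookup i∈)

  subset : {P : Pred (Fin n) ℓ} → Decidable P → Subset n
  subset P? = tabulate (does ∘ P?)

  ∈-subset⁻ : {P : Pred (Fin n) ℓ} (P? : Decidable P) {i : Fin n} → i ∈ subset P? → P i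
  ∈-subset⁻ P? {i} i∈ with P? i | ∈-tabulate⁻ {f = does ∘ P?} i∈
  ... | yes p | _  = p
  ... | no  _ | ()

module Arithmetic where

  open import Data.Integer using (ℤ; +_; _+_; _*_; _-_; _≤_; _<_; 0ℤ; 1ℤ; +≤+; +<+; nonNegative)
  open import Data.Integer.Properties hiding (_≟_)
  open import Data.Integer.Tactic.RingSolver using (solve-∀)
  open import Data.Nat as ℕ using (ℕ; z≤n; s≤s; _⊓_; _∸_)
  import Data.Nat.Properties as ℕ
  open import Relation.Binary.PropositionalEquality
  open import Relation.Nullary using (¬_; yes; no)
  open IntegerLemmas

  Deviation : (q a b : ℕ) → ℤ → Set
  Deviation q a b N =
    (Q * N - A * (Q - 1ℤ) * B) * (Q * N - A * (Q - 1ℤ) * B) ≤ B * (Q * (A * A) * (Q - 1ℤ) + + 2 * (Q * Q * Q) * A)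
    where
    Q A B : ℤ
    Q = + q
    A = + a
    B = + b

  module _ {q a b : ℕ} where
    private
      Q A B : ℤ
      Q = + q
      A = + a
      B = + b

    -- via A B ≥ 6 Q + 1 and A ≤ Q, this is bounded below by a cubic in Q - 7 with positive coefficients
    excess-positive : a ℕ.≤ q → b ℕ.≤ q → 6 ℕ.* q ℕ.< a ℕ.* b →
                      1ℤ ≤ A * B * ((Q - 1ℤ) * (Q - 1ℤ)) - Q * A * (Q - 1ℤ) - + 2 * (Q * Q * Q)
    excess-positive a≤q b≤q 6q<ab = begin
      1ℤ
        ≤⟨ +-mono-≤ (+≤+ (s≤s z≤n))
                    (*-nonNeg t≥0 (+-nonNeg (0≤+ 305) (*-nonNeg t≥0 (+-nonNeg (0≤+ 53) (*-nonNeg (0≤+ 3) t≥0))))) ⟩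
      + 568 + t * (+ 305 + t * (+ 53 + + 3 * t))
        ≡⟨ trans (cong lower (+n≡+m++[n∸m] 7≤q)) (cubic t) ⟨
      lower Q
        ≤⟨ +-monoˡ-≤ _ (+-mono-≤ (*-monoʳ-≤-nonNeg _ {{nonNegative (x*x-nonNeg (Q - 1ℤ))}} 6Q+1≤AB)
      (neg-mono-≤ (*-monoʳ-≤-nonNeg _ {{nonNegative Q-1≥0}} (*-monoˡ-≤-0≤ (0≤+ q) (+≤+ a≤q))))) ⟩
      A * B * ((Q - 1ℤ) * (Q - 1ℤ)) - Q * A * (Q - 1ℤ) - + 2 * (Q * Q * Q) ∎
      where
      open ≤-Reasoning
      lower : ℤ → ℤ
      lower Q = (+ 6 * Q + 1ℤ) * ((Q - 1ℤ) * (Q - 1ℤ)) - Q * Q * (Q - 1ℤ) - + 2 * (Q * Q * Q)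
      cubic : ∀ t → (+ 6 * (+ 7 + t) + 1ℤ) * ((+ 7 + t - 1ℤ) * (+ 7 + t - 1ℤ))
                    - (+ 7 + t) * (+ 7 + t) * (+ 7 + t - 1ℤ) - + 2 * ((+ 7 + t) * (+ 7 + t) * (+ 7 + t))
                    ≡ + 568 + t * (+ 305 + t * (+ 53 + + 3 * t))
      cubic = solve-∀
      7≤q : 7 ℕ.≤ q
      7≤q = ℕ.*-cancelʳ-< q 6 q (ℕ.<-≤-trans 6q<ab (ℕ.*-mono-≤ a≤q b≤q))
      t = + (q ∸ 7)
      t≥0 : 0ℤ ≤ t
      t≥0 = 0≤+ (q ∸ 7)
      Q-1≥0 : 0ℤ ≤ Q - 1ℤ
      Q-1≥0 = ≤-trans (0≤+ (q ∸ 1)) (≤-reflexive (+[m∸n]≡+m-+n (ℕ.≤-trans (s≤s z≤n) 7≤q)))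
      6Q+1≤AB : + 6 * Q + 1ℤ ≤ A * B
      6Q+1≤AB = begin
        + 6 * Q + 1ℤ        ≡⟨ cong (_+ 1ℤ) (pos-* 6 q) ⟨
        + (6 ℕ.* q ℕ.+ 1)   ≤⟨ +≤+ (ℕ.≤-trans (ℕ.≤-reflexive (ℕ.+-comm (6 ℕ.* q) 1)) 6q<ab) ⟩
        + (a ℕ.* b)         ≡⟨ pos-* a b ⟩
        A * B               ∎

    -- at N = 0 the left-hand side exceeds the right-hand side by A B times the quantity above
    ¬deviation-at-zero : a ℕ.≤ q → b ℕ.≤ q → 6 ℕ.* q ℕ.< a ℕ.* b → ¬ Deviation q a b 0ℤ
    ¬deviation-at-zero a≤q b≤q 6q<ab dev = <-irrefl refl (≤-<-trans dev (begin-strict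
      K                       ≡⟨ +-identityʳ K ⟨
      K + 0ℤ                  <⟨ +-monoʳ-< K (<-≤-trans (+<+ (s≤s z≤n)) 1≤AB*excess) ⟩
      K + A * B * excess      ≡⟨ split A B Q ⟨
      (Q * 0ℤ - A * (Q - 1ℤ) * B) * (Q * 0ℤ - A * (Q - 1ℤ) * B) ∎))
      where
      open ≤-Reasoning
      K = B * (Q * (A * A) * (Q - 1ℤ) + + 2 * (Q * Q * Q) * A)
      excess = A * B * ((Q - 1ℤ) * (Q - 1ℤ)) - Q * A * (Q - 1ℤ) - + 2 * (Q * Q * Q)
      split : ∀ A B Q → (Q * 0ℤ - A * (Q - 1ℤ) * B) * (Q * 0ℤ - A * (Q - 1ℤ) * B) ≡
              B * (Q * (A * A) * (Q - 1ℤ) + + 2 * (Q * Q * Q) * A) +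
              A * B * (A * B * ((Q - 1ℤ) * (Q - 1ℤ)) - Q * A * (Q - 1ℤ) - + 2 * (Q * Q * Q))
      split = solve-∀
      1≤AB : 1ℤ ≤ A * B
      1≤AB = ≤-trans (+≤+ (ℕ.≤-trans (s≤s z≤n) 6q<ab)) (≤-reflexive (pos-* a b))
      1≤AB*excess : 1ℤ ≤ A * B * excess
      1≤AB*excess = begin
        1ℤ                 ≤⟨ 1≤AB ⟩
        A * B              ≡⟨ *-identityʳ (A * B) ⟨
        A * B * 1ℤ         ≤⟨ *-monoˡ-≤-0≤ (≤-trans (0≤+ 1) 1≤AB) (excess-positive a≤q b≤q 6q<ab) ⟩
        A * B * excess     ∎

    deviation⇒positive : ∀ {N} → a ℕ.≤ q → b ℕ.≤ q → 6 ℕ.* q ℕ.< a ℕ.* b → 0ℤ ≤ N → Deviation q a b N → 0ℤ < N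
    deviation⇒positive a≤q b≤q 6q<ab 0≤N dev =
      ≤∧≢⇒< 0≤N (λ 0≡N → ¬deviation-at-zero a≤q b≤q 6q<ab (subst (Deviation q a b) (sym 0≡N) dev))

    deviation-rhs-≤ : 2 ℕ.≤ q → a ℕ.≤ q →
                      B * (Q * (A * A) * (Q - 1ℤ) + + 2 * (Q * Q * Q) * A) ≤ + 6 * A * B * (Q - 1ℤ) * (Q * Q)
    deviation-rhs-≤ 2≤q a≤q = begin
      B * (Q * (A * A) * (Q - 1ℤ) + + 2 * (Q * Q * Q) * A)
        ≡⟨ factor A B Q ⟩
      A * B * Q * (A * (Q - 1ℤ) + + 2 * (Q * Q))
        ≤⟨ *-monoˡ-≤-0≤ (*-nonNeg (*-nonNeg (0≤+ a) (0≤+ b)) (0≤+ q)) (+-monoˡ-≤ _ A[Q-1]≤Q[Q-1]) ⟩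
      A * B * Q * (Q * (Q - 1ℤ) + + 2 * (Q * Q))
        ≤⟨ *-monoˡ-≤-0≤ (*-nonNeg (*-nonNeg (0≤+ a) (0≤+ b)) (0≤+ q)) quadratic ⟩
      A * B * Q * (+ 6 * (Q - 1ℤ) * Q)
        ≡⟨ unfactor A B Q ⟩
      + 6 * A * B * (Q - 1ℤ) * (Q * Q) ∎
      where
      open ≤-Reasoning
      factor : ∀ A B Q → B * (Q * (A * A) * (Q - 1ℤ) + + 2 * (Q * Q * Q) * A) ≡ A * B * Q * (A * (Q - 1ℤ) + + 2 * (Q * Q))
      factor = solve-∀
      unfactor : ∀ A B Q → A * B * Q * (+ 6 * (Q - 1ℤ) * Q) ≡ + 6 * A * B * (Q - 1ℤ) * (Q * Q)
      unfactor = solve-∀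
      Q-1≥0 : 0ℤ ≤ Q - 1ℤ
      Q-1≥0 = ≤-trans (0≤+ (q ∸ 1)) (≤-reflexive (+[m∸n]≡+m-+n (ℕ.≤-trans (s≤s z≤n) 2≤q)))
      A[Q-1]≤Q[Q-1] : A * (Q - 1ℤ) ≤ Q * (Q - 1ℤ)
      A[Q-1]≤Q[Q-1] = *-monoʳ-≤-nonNeg (Q - 1ℤ) {{nonNegative Q-1≥0}} (+≤+ a≤q)
      t = + (q ∸ 2)
      difference : ∀ t → + 6 * (+ 2 + t - 1ℤ) * (+ 2 + t) - ((+ 2 + t) * (+ 2 + t - 1ℤ) + + 2 * ((+ 2 + t) * (+ 2 + t)))
                         ≡ (+ 2 + t) * (1ℤ + + 3 * t)
      difference = solve-∀
      quadratic : Q * (Q - 1ℤ) + + 2 * (Q * Q) ≤ + 6 * (Q - 1ℤ) * Q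
      quadratic = 0≤i-j⇒j≤i (≤-trans (*-nonNeg (0≤+ (2 ℕ.+ (q ∸ 2))) (+-nonNeg (0≤+ 1) (*-nonNeg (0≤+ 3) (0≤+ (q ∸ 2)))))
        (≤-reflexive (sym (trans (cong (λ Q → + 6 * (Q - 1ℤ) * Q - (Q * (Q - 1ℤ) + + 2 * (Q * Q))) (+n≡+m++[n∸m] 2≤q))
                                 (difference t)))))

    private
      P : ℕ
      P = a ℕ.* b ℕ.* (q ∸ 1)

      L : ℕ → ℕ → ℕ
      L s d = d ℕ.* (a ⊓ b ∸ s) ℕ.* q ℕ.+ s ℕ.* (q ∸ 1) ℕ.* q

      +P≡ : 1 ℕ.≤ q → + P ≡ A * (Q - 1ℤ) * B
      +P≡ 1≤q = trans (pos-* (a ℕ.* b) (q ∸ 1)) (trans (cong₂ _*_ (pos-* a b) (+[m∸n]≡+m-+n 1≤q)) (reorder A B (Q - 1ℤ)))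
        where
        reorder : ∀ A B C → A * B * C ≡ A * C * B
        reorder = solve-∀

      +L≡ : ∀ {s} d → 1 ℕ.≤ q → s ℕ.≤ a ⊓ b → + L s d ≡ Q * (+ d * (+ (a ⊓ b) - + s) + + s * (Q - 1ℤ))
      +L≡ {s} d 1≤q s≤m = trans (pos-+ (d ℕ.* (a ⊓ b ∸ s) ℕ.* q) (s ℕ.* (q ∸ 1) ℕ.* q))
        (trans (cong₂ _+_ (trans (pos-* (d ℕ.* (a ⊓ b ∸ s)) q)
                                 (cong (_* Q) (trans (pos-* d (a ⊓ b ∸ s)) (cong (+ d *_) (+[m∸n]≡+m-+n s≤m)))))
                          (trans (pos-* (s ℕ.* (q ∸ 1)) q) (cong (_* Q) (trans (pos-* s (q ∸ 1)) (cong (+ s *_) (+[m∸n]≡+m-+n 1≤q))))))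
               (factor (+ d) (+ (a ⊓ b) - + s) (+ s) (Q - 1ℤ) Q))
        where
        factor : ∀ d m s r Q → d * m * Q + s * r * Q ≡ Q * (d * m + s * r)
        factor = solve-∀

      +rhs≡ : 1 ℕ.≤ q → + (6 ℕ.* a ℕ.* b ℕ.* (q ∸ 1) ℕ.* (q ℕ.* q)) ≡ + 6 * A * B * (Q - 1ℤ) * (Q * Q)
      +rhs≡ 1≤q = trans (pos-* (6 ℕ.* a ℕ.* b ℕ.* (q ∸ 1)) (q ℕ.* q))
        (cong₂ _*_ (trans (pos-* (6 ℕ.* a ℕ.* b) (q ∸ 1))
                          (cong₂ _*_ (trans (pos-* (6 ℕ.* a) b) (cong (_* B) (pos-* 6 a))) (+[m∸n]≡+m-+n 1≤q)))
                   (pos-* q q))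

    deviation⇒Bound53 : ∀ {s d N} → 2 ℕ.≤ q → a ℕ.≤ q → s ℕ.≤ a ⊓ b → Deviation q a b N →
                        N ≤ + d * (+ (a ⊓ b) - + s) + + s * (Q - 1ℤ) → Bound53 q a b s d
    deviation⇒Bound53 {s} {d} {N} 2≤q a≤q s≤m dev N≤ with P ℕ.≤? L s d
    ... | yes P≤L = subst (λ t → t ℕ.* t ℕ.≤ 6 ℕ.* a ℕ.* b ℕ.* (q ∸ 1) ℕ.* (q ℕ.* q)) (sym (ℕ.m≤n⇒m∸n≡0 P≤L)) z≤n
    ... | no  P≰L = drop‿+≤+ (begin
      + ((P ∸ L s d) ℕ.* (P ∸ L s d))                       ≡⟨ pos-* (P ∸ L s d) (P ∸ L s d) ⟩
      + (P ∸ L s d) * + (P ∸ L s d)                         ≤⟨ square-mono-≤ (0≤+ (P ∸ L s d)) excess≤ ⟩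
      (T * B - Q * N) * (T * B - Q * N)                     ≡⟨ swap (T * B) (Q * N) ⟩
      (Q * N - T * B) * (Q * N - T * B)                     ≤⟨ dev ⟩
      B * (Q * (A * A) * (Q - 1ℤ) + + 2 * (Q * Q * Q) * A)  ≤⟨ deviation-rhs-≤ 2≤q a≤q ⟩
      + 6 * A * B * (Q - 1ℤ) * (Q * Q)                      ≡⟨ +rhs≡ 1≤q ⟨
      + (6 ℕ.* a ℕ.* b ℕ.* (q ∸ 1) ℕ.* (q ℕ.* q))           ∎)
      where
      open ≤-Reasoning
      T = A * (Q - 1ℤ)
      1≤q = ℕ.≤-trans (s≤s z≤n) 2≤q
      swap : ∀ x y → (x - y) * (x - y) ≡ (y - x) * (y - x)
      swap = solve-∀
      excess≤ : + (P ∸ L s d) ≤ T * B - Q * N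
      excess≤ = begin
        + (P ∸ L s d)
          ≡⟨ +[m∸n]≡+m-+n (ℕ.≰⇒≥ P≰L) ⟩
        + P - + L s d
          ≤⟨ +-monoʳ-≤ (+ P) (neg-mono-≤ (≤-trans (*-monoˡ-≤-0≤ (0≤+ q) N≤) (≤-reflexive (sym (+L≡ d 1≤q s≤m))))) ⟩
        + P - Q * N
          ≡⟨ cong (_- Q * N) (+P≡ 1≤q) ⟩
        T * B - Q * N ∎

module FieldLemmas (F : FiniteField) where

  open import Level using (0ℓ)
  open import Algebra.Bundles using (CommutativeRing)
  open import Data.Empty using (⊥-elim)
  open import Data.Fin.Properties using (_≟_)
  open import Data.Nat using (_≤_; zero; suc; s≤s; z≤n)
  open import Relation.Binary.PropositionalEquality
  open import Relation.Nullary using (yes; no)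

  open FiniteField F

  commutativeRing : CommutativeRing 0ℓ 0ℓ
  commutativeRing = record { isCommutativeRing = isCommutativeRing }

  open CommutativeRing commutativeRing public
    using (_+_; _*_; -_; _-_; +-comm; +-identityˡ; +-identityʳ; *-comm; *-assoc; *-identityˡ; +-group; commutativeSemiring)
  open import Algebra.Properties.Group +-group public using (\\-leftDividesˡ; \\-leftDividesʳ; inverseˡ-unique)
  open import Algebra.Solver.Ring.NaturalCoefficients.Default commutativeSemiring

  +-cancelˡ : ∀ a {x y} → a + x ≡ a + y → x ≡ y
  +-cancelˡ a {x} {y} eq = begin
    x              ≡⟨ \\-leftDividesʳ a x ⟨
    - a + (a + x)  ≡⟨ cong (- a +_) eq ⟩
    - a + (a + y)  ≡⟨ \\-leftDividesʳ a y ⟩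
    y              ∎
    where open ≡-Reasoning

  +-cancelʳ : ∀ a {x y} → x + a ≡ y + a → x ≡ y
  +-cancelʳ a {x} {y} eq = +-cancelˡ a (trans (+-comm a x) (trans eq (+-comm y a)))

  _⁻¹ : ∀ a → a ≢ 0F → Fin q
  (a ⁻¹) a≢0 = proj₁ (inverse a a≢0)

  ⁻¹-inverseˡ : ∀ {a} (a≢0 : a ≢ 0F) x → (a ⁻¹) a≢0 * (a * x) ≡ x
  ⁻¹-inverseˡ {a} a≢0 x = begin
    a⁻¹ * (a * x)  ≡⟨ *-assoc a⁻¹ a x ⟨
    a⁻¹ * a * x    ≡⟨ cong (_* x) (trans (*-comm a⁻¹ a) (proj₂ (inverse a a≢0))) ⟩
    1F * x         ≡⟨ *-identityˡ x ⟩
    x              ∎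
    where
    open ≡-Reasoning
    a⁻¹ = (a ⁻¹) a≢0

  ⁻¹-inverseʳ : ∀ {a} (a≢0 : a ≢ 0F) x → a * ((a ⁻¹) a≢0 * x) ≡ x
  ⁻¹-inverseʳ {a} a≢0 x = begin
    a * (a⁻¹ * x)  ≡⟨ *-assoc a a⁻¹ x ⟨
    a * a⁻¹ * x    ≡⟨ cong (_* x) (proj₂ (inverse a a≢0)) ⟩
    1F * x         ≡⟨ *-identityˡ x ⟩
    x              ∎
    where
    open ≡-Reasoning
    a⁻¹ = (a ⁻¹) a≢0

  *-cancelˡ : ∀ {a} → a ≢ 0F → ∀ {x y} → a * x ≡ a * y → x ≡ y
  *-cancelˡ {a} a≢0 {x} {y} eq =
    trans (sym (⁻¹-inverseˡ a≢0 x)) (trans (cong ((a ⁻¹) a≢0 *_) eq) (⁻¹-inverseˡ a≢0 y))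

  -- (a - b) (x - c) = 0, stated without subtraction so that the semiring solver applies
  cross-cancel : ∀ {a b x c} → a ≢ b → a * x + b * c ≡ a * c + b * x → x ≡ c
  cross-cancel {a} {b} {x} {c} a≢b eq = *-cancelˡ d≢0 (+-cancelʳ (b * x + b * c) shifted)
    where
    d = - b + a
    a≡b+d : a ≡ b + d
    a≡b+d = sym (\\-leftDividesˡ b a)
    d≢0 : d ≢ 0F
    d≢0 d≡0 = a≢b (trans a≡b+d (trans (cong (b +_) d≡0) (+-identityʳ b)))
    shifted : d * x + (b * x + b * c) ≡ d * c + (b * x + b * c)
    shifted = begin
      d * x + (b * x + b * c)
        ≡⟨ solve 4 (λ b d x c → d :* x :+ (b :* x :+ b :* c) := (b :+ d) :* x :+ b :* c) refl b d x c ⟩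
      (b + d) * x + b * c
        ≡⟨ subst (λ t → t * x + b * c ≡ t * c + b * x) a≡b+d eq ⟩
      (b + d) * c + b * x
        ≡⟨ solve 4 (λ b d x c → (b :+ d) :* c :+ b :* x := d :* c :+ (b :* x :+ b :* c)) refl b d x c ⟩
      d * c + (b * x + b * c) ∎
      where open ≡-Reasoning

  linear-unique : ∀ {a b k k' v₁ v₂} → a ≢ b →
                  v₁ * a + k ≡ v₁ * b + k' → v₂ * a + k ≡ v₂ * b + k' → v₁ ≡ v₂
  linear-unique {a} {b} {k} {k'} {v₁} {v₂} a≢b e₁ e₂ with v₁ ≟ v₂
  ... | yes v₁≡v₂ = v₁≡v₂
  ... | no  v₁≢v₂ = ⊥-elim (a≢b (cross-cancel v₁≢v₂ (+-cancelʳ (k + k') (begin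
    v₁ * a + v₂ * b + (k + k')
      ≡⟨ solve 6 (λ a b k k' v₁ v₂ → v₁ :* a :+ v₂ :* b :+ (k :+ k') := (v₁ :* a :+ k) :+ (v₂ :* b :+ k'))
                 refl a b k k' v₁ v₂ ⟩
    (v₁ * a + k) + (v₂ * b + k')
      ≡⟨ cong₂ _+_ e₁ (sym e₂) ⟩
    (v₁ * b + k') + (v₂ * a + k)
      ≡⟨ solve 6 (λ a b k k' v₁ v₂ → (v₁ :* b :+ k') :+ (v₂ :* a :+ k) := v₁ :* b :+ v₂ :* a :+ (k :+ k'))
                 refl a b k k' v₁ v₂ ⟩
    v₁ * b + v₂ * a + (k + k') ∎))))
    where open ≡-Reasoning

  x-+[y-x] : ∀ x y → x + (y - x) ≡ y
  x-+[y-x] x y = trans (cong (x +_) (+-comm y (- x))) (\\-leftDividesˡ x y)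

  φ : Fin q → Fin q → Fin q
  φ x u = u * (x - u)

  φ-+ : ∀ u y → φ (u + y) u ≡ u * y
  φ-+ u y = cong (u *_) (trans (+-comm (u + y) (- u)) (\\-leftDividesʳ u y))

  φ-collision : ∀ {x x' v w} → φ x (v + w) ≡ φ x' v → v * x + w * x ≡ v * (x' + w + w) + w * w
  φ-collision {x} {x'} {v} {w} eq = +-cancelʳ (v * v) (begin
    v * x + w * x + v * v
      ≡⟨ solve 3 (λ v w x → v :* x :+ w :* x :+ v :* v := (v :+ w) :* x :+ v :* v) refl v w x ⟩
    u * x + v * v
      ≡⟨ cong (λ t → u * t + v * v) (sym (x-+[y-x] u x)) ⟩
    u * (u + α) + v * v
      ≡⟨ solve 3 (λ u α v → u :* (u :+ α) :+ v :* v := u :* α :+ (u :* u :+ v :* v)) refl u α v ⟩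
    u * α + (u * u + v * v)
      ≡⟨ cong (_+ (u * u + v * v)) eq ⟩
    v * β + (u * u + v * v)
      ≡⟨ solve 3 (λ u β v → v :* β :+ (u :* u :+ v :* v) := v :* (v :+ β) :+ u :* u) refl u β v ⟩
    v * (v + β) + u * u
      ≡⟨ cong (λ t → v * t + u * u) (x-+[y-x] v x') ⟩
    v * x' + u * u
      ≡⟨ solve 3 (λ v w x' → v :* x' :+ (v :+ w) :* (v :+ w) := v :* (x' :+ w :+ w) :+ w :* w :+ v :* v) refl v w x' ⟩
    v * (x' + w + w) + w * w + v * v ∎)
    where
    open ≡-Reasoning
    u = v + w
    α = x - u
    β = x' - v

  φ-collision-unshifted : ∀ {x x' v} → v ≢ 0F → φ x (v + 0F) ≡ φ x' v → x ≡ x'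
  φ-collision-unshifted {x} {x'} {v} v≢0 eq = *-cancelˡ v≢0 (begin
    v * x
      ≡⟨ solve 2 (λ v x → v :* x := v :* x :+ con 0 :* x) refl v x ⟩
    v * x + 0F * x
      ≡⟨ φ-collision eq ⟩
    v * (x' + 0F + 0F) + 0F * 0F
      ≡⟨ solve 2 (λ v x' → v :* (x' :+ con 0 :+ con 0) :+ con 0 :* con 0 := v :* x') refl v x' ⟩
    v * x' ∎)
    where open ≡-Reasoning

  φ-collision-degenerate : ∀ {x x' v w} → w ≢ 0F → x ≡ x' + w + w → φ x (v + w) ≡ φ x' v → w ≡ x × x' ≡ - x
  φ-collision-degenerate {x} {x'} {v} {w} w≢0 x≡x'+2w eq = sym x≡w , inverseˡ-unique x' x x'+x≡0
    where
    x≡w : x ≡ w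
    x≡w = *-cancelˡ w≢0 (+-cancelˡ (v * x) (trans (φ-collision eq) (cong (λ t → v * t + w * w) (sym x≡x'+2w))))
    x'+x≡0 : x' + x ≡ 0F
    x'+x≡0 = +-cancelʳ x (trans (sym (subst (λ t → x ≡ x' + t + t) (sym x≡w) x≡x'+2w)) (sym (+-identityˡ x)))

  φ-collision-unique : ∀ {x x' w v₁ v₂} → x ≢ x' + w + w →
                       φ x (v₁ + w) ≡ φ x' v₁ → φ x (v₂ + w) ≡ φ x' v₂ → v₁ ≡ v₂
  φ-collision-unique x≢x'+2w e₁ e₂ = linear-unique x≢x'+2w (φ-collision e₁) (φ-collision e₂)

  2≤q : 2 ≤ q
  2≤q = two-distinct 0F 1F 0≢1
    where
    two-distinct : ∀ {n} (a b : Fin n) → a ≢ b → 2 ≤ n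
    two-distinct {suc zero}    Fin.zero Fin.zero a≢b = ⊥-elim (a≢b refl)
    two-distinct {suc (suc n)} _        _        _   = s≤s (s≤s z≤n)

module Counting (F : FiniteField) (E₁ E₂ : Subset (FiniteField.q F)) where

  open import Data.Bool using (true; false; _∧_; not)
  import Data.Bool as Bool
  open import Data.Fin.Properties using (_≟_)
  open import Data.Integer using (ℤ; +_; _+_; _*_; -_; _-_; _≤_; _<_; 0ℤ; 1ℤ; +≤+; +<+)
  open import Data.Integer.Properties hiding (_≟_)
  open import Data.Integer.Tactic.RingSolver using (solve-∀)
  open import Data.Nat as ℕ using (ℕ; _⊓_)
  import Data.Nat.Properties as ℕ
  open import Data.Sum using (inj₁; inj₂)
  open import Data.Vec using (lookup; tabulate)
  open import Data.Vec.Properties using (lookup⇒[]=)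
  open import Function using (_∘_)
  open import Relation.Binary.PropositionalEquality
  open import Relation.Nullary using (does; ¬_; yes; no; contradiction)
  open import Relation.Nullary.Decidable using (¬?; _×-dec_)
  open import Relation.Unary using (Decidable)
  open import Algebra.Properties.Semiring.Sum +-*-semiring using (sum-replicate-zero)
  open IntegerLemmas
  open FiniteSums
  open Arithmetic using (Deviation)
  open FiniteField F using (q; 0F)
  open FieldLemmas F
    using (φ; φ-+; _⁻¹; ⁻¹-inverseˡ; ⁻¹-inverseʳ; φ-collision-unshifted; φ-collision-degenerate; φ-collision-unique;
           \\-leftDividesˡ; \\-leftDividesʳ)
    renaming (_+_ to infixl 6 _⊕_; _*_ to infixl 7 _⊗_; -_ to ⊖_; +-comm to ⊕-comm; *-comm to ⊗-comm)

  χ : Subset q → Fin q → ℤ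
  χ E x = 𝟙 (lookup E x)

  χ* : Fin q → ℤ
  χ* u = 𝟙 (not (does (u ≟ 0F)))

  χ-nonNeg : ∀ E x → 0ℤ ≤ χ E x
  χ-nonNeg E x = 𝟙-nonNeg (lookup E x)

  χ*-nonNeg : ∀ u → 0ℤ ≤ χ* u
  χ*-nonNeg u = 𝟙-nonNeg (not (does (u ≟ 0F)))

  χ*-*-≤ : ∀ u {t} → 0ℤ ≤ t → χ* u * t ≤ t
  χ*-*-≤ u = 𝟙-*-≤ (not (does (u ≟ 0F)))

  Q A B : ℤ
  Q = + q
  A = + ∣ E₁ ∣
  B = + ∣ E₂ ∣

  ∑χ : ∀ E → sum (χ E) ≡ + ∣ E ∣
  ∑χ E = sym (∣p∣≡∑𝟙 E)

  ∑χ* : sum χ* ≡ Q - 1ℤ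
  ∑χ* = begin
    sum χ*
      ≡⟨ x≡x+1-1 (sum χ*) ⟩
    sum χ* + 1ℤ - 1ℤ
      ≡⟨ cong (λ t → sum χ* + t - 1ℤ) (∑-δ′ 0F (λ _ → 1ℤ)) ⟨
    sum χ* + ∑[ u < q ] (δ u 0F * 1ℤ) - 1ℤ
      ≡⟨ cong (λ t → sum χ* + t - 1ℤ) (sum-cong-≗ (λ u → *-identityʳ (δ u 0F))) ⟩
    sum χ* + ∑[ u < q ] δ u 0F - 1ℤ
      ≡⟨ cong (_- 1ℤ) (∑-distrib-+ χ* (λ u → δ u 0F)) ⟨
    ∑[ u < q ] (χ* u + δ u 0F) - 1ℤ
      ≡⟨ cong (_- 1ℤ) (sum-cong-≗ (λ u → 𝟙-not+𝟙 (does (u ≟ 0F)))) ⟩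
    ∑[ u < q ] 1ℤ - 1ℤ
      ≡⟨ cong (_- 1ℤ) (trans (∑-const q 1ℤ) (*-identityʳ Q)) ⟩
    Q - 1ℤ ∎
    where
    open ≡-Reasoning
    x≡x+1-1 : ∀ x → x ≡ x + 1ℤ - 1ℤ
    x≡x+1-1 = solve-∀

  ∑-translate : ∀ a (f : Fin q → ℤ) → ∑[ y < q ] f (a ⊕ y) ≡ sum f
  ∑-translate a = ∑-reindex (a ⊕_) (⊖ a ⊕_) (\\-leftDividesˡ a) (\\-leftDividesʳ a)

  ∑-scale : ∀ {a} → a ≢ 0F → (f : Fin q → ℤ) → ∑[ y < q ] f (a ⊗ y) ≡ sum f
  ∑-scale {a} a≢0 = ∑-reindex (a ⊗_) ((a ⁻¹) a≢0 ⊗_) (⁻¹-inverseʳ a≢0) (⁻¹-inverseˡ a≢0)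

  solutions : Fin q → ℤ
  solutions u = ∑[ y < q ] (χ E₁ (u ⊕ y) * χ E₂ (u ⊗ y))

  N : ℤ
  N = ∑[ u < q ] (χ* u * solutions u)

  fibre : Fin q → Fin q → ℤ
  fibre x = pushforward χ* (φ x)

  R : Fin q → ℤ
  R z = ∑[ x < q ] (χ E₁ x * fibre x z)

  ∑-*-R : (b : Fin q → ℤ) → ∑[ z < q ] (b z * R z) ≡ ∑[ x < q ] (χ E₁ x * ∑[ u < q ] (χ* u * b (φ x u)))
  ∑-*-R b = trans (∑-*-∑-comm b (χ E₁) (λ z x → fibre x z)) (sum-cong-≗ (λ x → cong (χ E₁ x *_) (∑-*-pushforward b χ* (φ x))))

  ∑-χ₂-R : ∑[ z < q ] (χ E₂ z * R z) ≡ N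
  ∑-χ₂-R = begin
    ∑[ z < q ] (χ E₂ z * R z)
      ≡⟨ ∑-*-R (χ E₂) ⟩
    ∑[ x < q ] (χ E₁ x * ∑[ u < q ] (χ* u * χ E₂ (φ x u)))
      ≡⟨ ∑-*-∑-comm (χ E₁) χ* (λ x u → χ E₂ (φ x u)) ⟩
    ∑[ u < q ] (χ* u * ∑[ x < q ] (χ E₁ x * χ E₂ (φ x u)))
      ≡⟨ sum-cong-≗ (λ u → cong (χ* u *_) (∑-translate u (λ x → χ E₁ x * χ E₂ (φ x u)))) ⟨
    ∑[ u < q ] (χ* u * ∑[ y < q ] (χ E₁ (u ⊕ y) * χ E₂ (φ (u ⊕ y) u)))
      ≡⟨ sum-cong-≗ (λ u → cong (χ* u *_) (sum-cong-≗ (λ y → cong (λ t → χ E₁ (u ⊕ y) * χ E₂ t) (φ-+ u y)))) ⟩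
    N ∎
    where open ≡-Reasoning

  ∑R : sum R ≡ A * (Q - 1ℤ)
  ∑R = begin
    sum R
      ≡⟨ sum-cong-≗ (λ z → *-identityˡ (R z)) ⟨
    ∑[ z < q ] (1ℤ * R z)
      ≡⟨ ∑-*-R (λ _ → 1ℤ) ⟩
    ∑[ x < q ] (χ E₁ x * ∑[ u < q ] (χ* u * 1ℤ))
      ≡⟨ sum-cong-≗ (λ x → cong (χ E₁ x *_) (trans (sum-cong-≗ (λ u → *-identityʳ (χ* u))) ∑χ*)) ⟩
    ∑[ x < q ] (χ E₁ x * (Q - 1ℤ))
      ≡⟨ *-distribʳ-sum (Q - 1ℤ) (χ E₁) ⟨
    sum (χ E₁) * (Q - 1ℤ)
      ≡⟨ cong (_* (Q - 1ℤ)) (∑χ E₁) ⟩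
    A * (Q - 1ℤ) ∎
    where open ≡-Reasoning

  collisions : Fin q → Fin q → ℤ
  collisions x x' = ∑[ u < q ] (χ* u * fibre x' (φ x u))

  ∑R² : ∑[ z < q ] (R z * R z) ≡ ∑[ x < q ] (χ E₁ x * ∑[ x' < q ] (χ E₁ x' * collisions x x'))
  ∑R² = trans (∑-*-R R) (sum-cong-≗ (λ x → cong (χ E₁ x *_) (∑-*-∑-comm χ* (χ E₁) (λ u x' → fibre x' (φ x u)))))

  module _ (x x' : Fin q) where

    -- writing u = v ⊕ w, Δ w v records the collision φ x u = φ x' v
    Δ : Fin q → Fin q → ℤ
    Δ w v = δ (φ x' v) (φ x (v ⊕ w))

    shifted : Fin q → ℤ
    shifted w = ∑[ v < q ] (χ* v * (χ* (v ⊕ w) * Δ w v))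

    collisions≡∑shifted : collisions x x' ≡ sum shifted
    collisions≡∑shifted = begin
      ∑[ u < q ] (χ* u * ∑[ v < q ] (χ* v * δ (φ x' v) (φ x u)))
        ≡⟨ ∑-*-∑-comm χ* χ* (λ u v → δ (φ x' v) (φ x u)) ⟩
      ∑[ v < q ] (χ* v * ∑[ u < q ] (χ* u * δ (φ x' v) (φ x u)))
        ≡⟨ sum-cong-≗ (λ v → cong (χ* v *_) (∑-translate v (λ u → χ* u * δ (φ x' v) (φ x u)))) ⟨
      ∑[ v < q ] (χ* v * ∑[ w < q ] (χ* (v ⊕ w) * Δ w v))
        ≡⟨ sum-cong-≗ (λ v → *-distribˡ-sum (χ* v) (λ w → χ* (v ⊕ w) * Δ w v)) ⟩
      ∑[ v < q ] ∑[ w < q ] (χ* v * (χ* (v ⊕ w) * Δ w v))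
        ≡⟨ ∑-comm (λ v w → χ* v * (χ* (v ⊕ w) * Δ w v)) ⟩
      sum shifted ∎
      where open ≡-Reasoning

    Qδδ-nonNeg : (a b c d : Fin q) → 0ℤ ≤ Q * (δ a b * δ c d)
    Qδδ-nonNeg a b c d = *-nonNeg (0≤+ q) (*-nonNeg (δ-nonNeg a b) (δ-nonNeg c d))

    term-≤Δ : ∀ w v → χ* v * (χ* (v ⊕ w) * Δ w v) ≤ Δ w v
    term-≤Δ w v = ≤-trans (χ*-*-≤ v (*-nonNeg (χ*-nonNeg (v ⊕ w)) Δ-nonNeg)) (χ*-*-≤ (v ⊕ w) Δ-nonNeg)
      where
      Δ-nonNeg = δ-nonNeg (φ x' v) (φ x (v ⊕ w))

    shifted-≤ : ∀ w → shifted w ≤ χ* w + Q * (δ w 0F * δ x x') + Q * (δ w x * δ x' (⊖ x))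
    shifted-≤ w with w ≟ 0F
    shifted-≤ w | yes refl with x ≟ x'
    ... | yes x≡x' = ≤-trans all-terms-≤1
                       (≤-trans (≤-reflexive (sym (trans (+-identityˡ _) (*-identityʳ Q)))) (i≤i+nonNeg (Qδδ-nonNeg 0F x x' (⊖ x))))
      where
      all-terms-≤1 : shifted 0F ≤ Q
      all-terms-≤1 = ≤-trans (∑-mono-≤ (λ v → ≤-trans (term-≤Δ 0F v) (𝟙-≤1 _)))
                             (≤-reflexive (trans (∑-const q 1ℤ) (*-identityʳ Q)))
    ... | no  x≢x' = ≤-trans no-terms (+-nonNeg (+-nonNeg ≤-refl (*-nonNeg (0≤+ q) ≤-refl)) (Qδδ-nonNeg 0F x x' (⊖ x)))
      where
      term≡0 : ∀ v → χ* v * (χ* (v ⊕ 0F) * Δ 0F v) ≡ 0ℤ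
      term≡0 v with v ≟ 0F
      ... | yes _   = refl
      ... | no  v≢0 = trans (cong (λ t → 1ℤ * (χ* (v ⊕ 0F) * t)) (δ-≢ (x≢x' ∘ φ-collision-unshifted v≢0 ∘ sym)))
                            (cong (1ℤ *_) (*-zeroʳ (χ* (v ⊕ 0F))))
      no-terms : shifted 0F ≤ 0ℤ
      no-terms = ≤-reflexive (trans (sum-cong-≗ term≡0) (sum-replicate-zero q))
    shifted-≤ w | no w≢0 with x ≟ x' ⊕ w ⊕ w
    ... | no  x≢x'+2w = ≤-trans (≤-trans (∑-mono-≤ (term-≤Δ w)) at-most-one) (i≤i+nonNeg (Qδδ-nonNeg w x x' (⊖ x)))
      where
      at-most-one : sum (Δ w) ≤ 1ℤ + Q * (0ℤ * δ x x')
      at-most-one = ≤-trans (∑-δ-unique≤1 (φ x') (λ v → φ x (v ⊕ w)) (λ e₁ e₂ → φ-collision-unique x≢x'+2w (sym e₁) (sym e₂)))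
                            (i≤i+nonNeg (*-nonNeg (0≤+ q) ≤-refl))
    ... | yes x≡x'+2w = ≤-trans (≤-trans (∑-mono-≤ degenerate) (≤-reflexive (∑-const q _)))
                                (i≤nonNeg+i (+-nonNeg (0≤+ 1) (*-nonNeg (0≤+ q) ≤-refl)))
      where
      degenerate : ∀ v → χ* v * (χ* (v ⊕ w) * Δ w v) ≤ δ w x * δ x' (⊖ x)
      degenerate v = ≤-trans (term-≤Δ w v) (δ-≤-δ*δ (φ-collision-degenerate w≢0 x≡x'+2w ∘ sym))

    collisions-≤ : collisions x x' ≤ (Q - 1ℤ) + Q * δ x x' + Q * δ x' (⊖ x)
    collisions-≤ = begin
      collisions x x'
        ≡⟨ collisions≡∑shifted ⟩
      sum shifted
        ≤⟨ ∑-mono-≤ shifted-≤ ⟩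
      ∑[ w < q ] (χ* w + Q * (δ w 0F * δ x x') + Q * (δ w x * δ x' (⊖ x)))
        ≡⟨ ∑-distrib-+₃ χ* (λ w → Q * (δ w 0F * δ x x')) (λ w → Q * (δ w x * δ x' (⊖ x))) ⟩
      sum χ* + ∑[ w < q ] (Q * (δ w 0F * δ x x')) + ∑[ w < q ] (Q * (δ w x * δ x' (⊖ x)))
        ≡⟨ cong₂ _+_ (cong₂ _+_ ∑χ* (∑-Qδ 0F (δ x x'))) (∑-Qδ x (δ x' (⊖ x))) ⟩
      (Q - 1ℤ) + Q * δ x x' + Q * δ x' (⊖ x) ∎
      where
      open ≤-Reasoning
      ∑-Qδ : ∀ a c → ∑[ w < q ] (Q * (δ w a * c)) ≡ Q * c
      ∑-Qδ a c = trans (sym (*-distribˡ-sum Q (λ w → δ w a * c))) (cong (Q *_) (∑-δ′ a (λ _ → c)))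

  ∑R²-≤ : ∑[ z < q ] (R z * R z) ≤ (Q - 1ℤ) * (A * A) + + 2 * Q * A
  ∑R²-≤ = begin
    ∑[ z < q ] (R z * R z)
      ≡⟨ ∑R² ⟩
    ∑[ x < q ] (χ E₁ x * ∑[ x' < q ] (χ E₁ x' * collisions x x'))
      ≤⟨ ∑-mono-≤ (λ x → *-monoˡ-≤-0≤ (χ-nonNeg E₁ x)
                          (∑-mono-≤ (λ x' → *-monoˡ-≤-0≤ (χ-nonNeg E₁ x') (collisions-≤ x x')))) ⟩
    ∑[ x < q ] (χ E₁ x * ∑[ x' < q ] (χ E₁ x' * ((Q - 1ℤ) + Q * δ x x' + Q * δ x' (⊖ x))))
      ≡⟨ sum-cong-≗ (λ x → cong (χ E₁ x *_) (row x)) ⟩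
    ∑[ x < q ] (χ E₁ x * ((Q - 1ℤ) * A + Q * χ E₁ x + Q * χ E₁ (⊖ x)))
      ≤⟨ ∑-mono-≤ (λ x → *-monoˡ-≤-0≤ (χ-nonNeg E₁ x) (+-mono-≤ (+-monoʳ-≤ ((Q - 1ℤ) * A) (Q*χ≤Q x)) (Q*χ≤Q (⊖ x)))) ⟩
    ∑[ x < q ] (χ E₁ x * ((Q - 1ℤ) * A + Q * 1ℤ + Q * 1ℤ))
      ≡⟨ *-distribʳ-sum _ (χ E₁) ⟨
    sum (χ E₁) * ((Q - 1ℤ) * A + Q * 1ℤ + Q * 1ℤ)
      ≡⟨ trans (cong (_* ((Q - 1ℤ) * A + Q * 1ℤ + Q * 1ℤ)) (∑χ E₁)) (collect A Q) ⟩
    (Q - 1ℤ) * (A * A) + + 2 * Q * A ∎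
    where
    open ≤-Reasoning
    Q*χ≤Q : ∀ x → Q * χ E₁ x ≤ Q * 1ℤ
    Q*χ≤Q x = *-monoˡ-≤-0≤ (0≤+ q) (𝟙-≤1 (lookup E₁ x))
    collect : ∀ A Q → A * ((Q - 1ℤ) * A + Q * 1ℤ + Q * 1ℤ) ≡ (Q - 1ℤ) * (A * A) + + 2 * Q * A
    collect = solve-∀
    spread : ∀ c Q d₁ d₂ → c * ((Q - 1ℤ) + Q * d₁ + Q * d₂) ≡ (Q - 1ℤ) * c + Q * (d₁ * c) + Q * (d₂ * c)
    spread = solve-∀
    row : ∀ x → ∑[ x' < q ] (χ E₁ x' * ((Q - 1ℤ) + Q * δ x x' + Q * δ x' (⊖ x))) ≡
                (Q - 1ℤ) * A + Q * χ E₁ x + Q * χ E₁ (⊖ x)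
    row x = begin-equality
      ∑[ x' < q ] (χ E₁ x' * ((Q - 1ℤ) + Q * δ x x' + Q * δ x' (⊖ x)))
        ≡⟨ sum-cong-≗ (λ x' → spread (χ E₁ x') Q (δ x x') (δ x' (⊖ x))) ⟩
      ∑[ x' < q ] ((Q - 1ℤ) * χ E₁ x' + Q * (δ x x' * χ E₁ x') + Q * (δ x' (⊖ x) * χ E₁ x'))
        ≡⟨ ∑-distrib-+₃ (λ x' → (Q - 1ℤ) * χ E₁ x') (λ x' → Q * (δ x x' * χ E₁ x')) (λ x' → Q * (δ x' (⊖ x) * χ E₁ x')) ⟩
      ∑[ x' < q ] ((Q - 1ℤ) * χ E₁ x') + ∑[ x' < q ] (Q * (δ x x' * χ E₁ x')) + ∑[ x' < q ] (Q * (δ x' (⊖ x) * χ E₁ x'))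
        ≡⟨ cong₂ _+_ (cong₂ _+_ (sym (*-distribˡ-sum (Q - 1ℤ) (χ E₁)))
                                (sym (*-distribˡ-sum Q (λ x' → δ x x' * χ E₁ x'))))
                     (sym (*-distribˡ-sum Q (λ x' → δ x' (⊖ x) * χ E₁ x'))) ⟩
      (Q - 1ℤ) * sum (χ E₁) + Q * ∑[ x' < q ] (δ x x' * χ E₁ x') + Q * ∑[ x' < q ] (δ x' (⊖ x) * χ E₁ x')
        ≡⟨ cong₂ _+_ (cong₂ _+_ (cong ((Q - 1ℤ) *_) (∑χ E₁)) (cong (Q *_) (∑-δ x (χ E₁))))
                     (cong (Q *_) (∑-δ′ (⊖ x) (χ E₁))) ⟩
      (Q - 1ℤ) * A + Q * χ E₁ x + Q * χ E₁ (⊖ x) ∎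

  T : ℤ
  T = A * (Q - 1ℤ)

  X : Fin q → ℤ
  X z = Q * R z - T

  ∑-χ₂-X : ∑[ z < q ] (χ E₂ z * X z) ≡ Q * N - T * B
  ∑-χ₂-X = begin
    ∑[ z < q ] (χ E₂ z * X z)
      ≡⟨ sum-cong-≗ (λ z → spread (χ E₂ z) (R z) Q T) ⟩
    ∑[ z < q ] (Q * (χ E₂ z * R z) + - T * χ E₂ z)
      ≡⟨ ∑-distrib-+ (λ z → Q * (χ E₂ z * R z)) (λ z → - T * χ E₂ z) ⟩
    ∑[ z < q ] (Q * (χ E₂ z * R z)) + ∑[ z < q ] (- T * χ E₂ z)
      ≡⟨ cong₂ _+_ (sym (*-distribˡ-sum Q (λ z → χ E₂ z * R z))) (sym (*-distribˡ-sum (- T) (χ E₂))) ⟩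
    Q * ∑[ z < q ] (χ E₂ z * R z) + - T * sum (χ E₂)
      ≡⟨ cong₂ (λ n b → Q * n + - T * b) ∑-χ₂-R (∑χ E₂) ⟩
    Q * N + - T * B
      ≡⟨ tidy Q N T B ⟩
    Q * N - T * B ∎
    where
    open ≡-Reasoning
    spread : ∀ e r Q T → e * (Q * r - T) ≡ Q * (e * r) + - T * e
    spread = solve-∀
    tidy : ∀ Q N T B → Q * N + - T * B ≡ Q * N - T * B
    tidy = solve-∀

  ∑X² : ∑[ z < q ] (X z * X z) ≡ Q * Q * ∑[ z < q ] (R z * R z) - Q * (T * T)
  ∑X² = begin
    ∑[ z < q ] (X z * X z)
      ≡⟨ sum-cong-≗ (λ z → expand Q (R z) T) ⟩
    ∑[ z < q ] (Q * Q * (R z * R z) + - (+ 2 * Q * T) * R z + T * T)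
      ≡⟨ ∑-distrib-+₃ (λ z → Q * Q * (R z * R z)) (λ z → - (+ 2 * Q * T) * R z) (λ _ → T * T) ⟩
    ∑[ z < q ] (Q * Q * (R z * R z)) + ∑[ z < q ] (- (+ 2 * Q * T) * R z) + ∑[ z < q ] (T * T)
      ≡⟨ cong₂ _+_ (cong₂ _+_ (sym (*-distribˡ-sum (Q * Q) (λ z → R z * R z))) (sym (*-distribˡ-sum (- (+ 2 * Q * T)) R)))
                   (∑-const q (T * T)) ⟩
    Q * Q * ∑[ z < q ] (R z * R z) + - (+ 2 * Q * T) * sum R + Q * (T * T)
      ≡⟨ cong (λ t → Q * Q * ∑[ z < q ] (R z * R z) + - (+ 2 * Q * T) * t + Q * (T * T)) ∑R ⟩
    Q * Q * ∑[ z < q ] (R z * R z) + - (+ 2 * Q * T) * T + Q * (T * T)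
      ≡⟨ tidy (Q * Q * ∑[ z < q ] (R z * R z)) Q T ⟩
    Q * Q * ∑[ z < q ] (R z * R z) - Q * (T * T) ∎
    where
    open ≡-Reasoning
    expand : ∀ Q r T → (Q * r - T) * (Q * r - T) ≡ Q * Q * (r * r) + - (+ 2 * Q * T) * r + T * T
    expand = solve-∀
    tidy : ∀ s Q T → s + - (+ 2 * Q * T) * T + Q * (T * T) ≡ s - Q * (T * T)
    tidy = solve-∀

  deviation : Deviation q ∣ E₁ ∣ ∣ E₂ ∣ N
  deviation = begin
    (Q * N - T * B) * (Q * N - T * B)
      ≡⟨ cong₂ _*_ ∑-χ₂-X ∑-χ₂-X ⟨
    ∑[ z < q ] (χ E₂ z * X z) * ∑[ z < q ] (χ E₂ z * X z)
      ≤⟨ cauchy-schwarz (χ E₂) X (χ-nonNeg E₂) ⟩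
    sum (χ E₂) * ∑[ z < q ] (χ E₂ z * (X z * X z))
      ≤⟨ *-monoˡ-≤-0≤ (∑-nonNeg (χ-nonNeg E₂)) (∑-mono-≤ (λ z → 𝟙-*-≤ (lookup E₂ z) (x*x-nonNeg (X z)))) ⟩
    sum (χ E₂) * ∑[ z < q ] (X z * X z)
      ≡⟨ cong₂ _*_ (∑χ E₂) ∑X² ⟩
    B * (Q * Q * ∑[ z < q ] (R z * R z) - Q * (T * T))
      ≤⟨ *-monoˡ-≤-0≤ (0≤+ ∣ E₂ ∣) (+-monoˡ-≤ _ (*-monoˡ-≤-0≤ (*-nonNeg (0≤+ q) (0≤+ q)) ∑R²-≤)) ⟩
    B * (Q * Q * ((Q - 1ℤ) * (A * A) + + 2 * Q * A) - Q * (T * T))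
      ≡⟨ cong (B *_) (simplify Q A) ⟩
    B * (Q * (A * A) * (Q - 1ℤ) + + 2 * (Q * Q * Q) * A) ∎
    where
    open ≤-Reasoning
    simplify : ∀ Q A → Q * Q * ((Q - 1ℤ) * (A * A) + + 2 * Q * A) - Q * (A * (Q - 1ℤ) * (A * (Q - 1ℤ))) ≡
                       Q * (A * A) * (Q - 1ℤ) + + 2 * (Q * Q * Q) * A
    simplify = solve-∀

  N-nonNeg : 0ℤ ≤ N
  N-nonNeg = ∑-nonNeg (λ u → *-nonNeg (χ*-nonNeg u) (∑-nonNeg (λ y → *-nonNeg (χ-nonNeg E₁ (u ⊕ y)) (χ-nonNeg E₂ (u ⊗ y)))))

  witness : 0ℤ < N → ∃ λ u → ∃ λ y → y ≢ 0F × (u ⊕ y) ∈ E₁ × (u ⊗ y) ∈ E₂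
  witness 0<N with ∑-pos⇒∃-pos 0<N
  ... | u , 0<term with u ≟ 0F
  ...   | yes _ = contradiction 0<term λ { (+<+ ()) }
  ...   | no u≢0 with ∑-pos⇒∃-pos (<-≤-trans 0<term (≤-reflexive (*-identityˡ (solutions u))))
  ...     | y , 0<χχ with 𝟙*𝟙-pos (lookup E₁ (u ⊕ y)) (lookup E₂ (u ⊗ y)) 0<χχ
  ...       | u⊕y∈E₁ , u⊗y∈E₂ =
    y , u , u≢0 , lookup⇒[]= (y ⊕ u) E₁ (trans (cong (lookup E₁) (⊕-comm y u)) u⊕y∈E₁)
                , lookup⇒[]= (y ⊗ u) E₂ (trans (cong (lookup E₂) (⊗-comm y u)) u⊗y∈E₂)

  Y : Fin q → Subset q
  Y u = tabulate (λ y → lookup E₁ (u ⊕ y) ∧ lookup E₂ (u ⊗ y))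

  ∣Y∣ : ∀ u → + ∣ Y u ∣ ≡ solutions u
  ∣Y∣ u = trans (∣tabulate∣≡∑𝟙 (λ y → lookup E₁ (u ⊕ y) ∧ lookup E₂ (u ⊗ y)))
                (sum-cong-≗ (λ y → 𝟙-∧ (lookup E₁ (u ⊕ y)) (lookup E₂ (u ⊗ y))))

  ∈-Y : ∀ {u y} → y ∈ Y u → (u ⊕ y) ∈ E₁ × (u ⊗ y) ∈ E₂
  ∈-Y {u} {y} y∈Y with lookup E₁ (u ⊕ y) in e₁ | lookup E₂ (u ⊗ y) in e₂ | ∈-tabulate⁻ y∈Y
  ... | true  | true  | _  = lookup⇒[]= (u ⊕ y) E₁ e₁ , lookup⇒[]= (u ⊗ y) E₂ e₂
  ... | true  | false | ()
  ... | false | _     | ()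

  solutions-≤ : ∀ {u} → u ≢ 0F → solutions u ≤ + (∣ E₁ ∣ ⊓ ∣ E₂ ∣)
  solutions-≤ {u} u≢0 with ℕ.⊓-sel ∣ E₁ ∣ ∣ E₂ ∣
  ... | inj₁ m≡a = subst (λ m → solutions u ≤ + m) (sym m≡a) (begin
    solutions u                ≤⟨ ∑-mono-≤ (λ y → *-𝟙-≤ (lookup E₂ (u ⊗ y)) (χ-nonNeg E₁ (u ⊕ y))) ⟩
    ∑[ y < q ] χ E₁ (u ⊕ y)    ≡⟨ trans (∑-translate u (χ E₁)) (∑χ E₁) ⟩
    A                          ∎)
    where open ≤-Reasoning
  ... | inj₂ m≡b = subst (λ m → solutions u ≤ + m) (sym m≡b) (begin
    solutions u                ≤⟨ ∑-mono-≤ (λ y → 𝟙-*-≤ (lookup E₁ (u ⊕ y)) (χ-nonNeg E₂ (u ⊗ y))) ⟩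
    ∑[ y < q ] χ E₂ (u ⊗ y)    ≡⟨ trans (∑-scale u≢0 (χ E₂)) (∑χ E₂) ⟩
    B                          ∎)
    where open ≤-Reasoning

  module _ (s : ℕ) where

    D? : Decidable (λ u → u ≢ 0F × s ℕ.≤ ∣ Y u ∣)
    D? u = ¬? (u ≟ 0F) ×-dec (s ℕ.≤? ∣ Y u ∣)

    D : Subset q
    D = subset D?

    ∈-D : ∀ {u} → u ∈ D → u ≢ 0F × s ℕ.≤ ∣ Y u ∣
    ∈-D = ∈-subset⁻ D?

    N-≤ : s ℕ.≤ ∣ E₁ ∣ ⊓ ∣ E₂ ∣ → N ≤ + ∣ D ∣ * (+ (∣ E₁ ∣ ⊓ ∣ E₂ ∣) - + s) + + s * (Q - 1ℤ)
    N-≤ s≤m = begin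
      N
        ≤⟨ ∑-mono-≤ split ⟩
      ∑[ u < q ] (𝟙 (does (D? u)) * (M - S) + S * χ* u)
        ≡⟨ ∑-distrib-+ (λ u → 𝟙 (does (D? u)) * (M - S)) (λ u → S * χ* u) ⟩
      ∑[ u < q ] (𝟙 (does (D? u)) * (M - S)) + ∑[ u < q ] (S * χ* u)
        ≡⟨ cong₂ _+_ (sym (*-distribʳ-sum (M - S) (𝟙 ∘ does ∘ D?))) (sym (*-distribˡ-sum S χ*)) ⟩
      ∑[ u < q ] 𝟙 (does (D? u)) * (M - S) + S * sum χ*
        ≡⟨ cong₂ (λ d c → d * (M - S) + S * c) (sym (∣tabulate∣≡∑𝟙 (does ∘ D?))) ∑χ* ⟩
      + ∣ D ∣ * (M - S) + S * (Q - 1ℤ) ∎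
      where
      open ≤-Reasoning
      M = + (∣ E₁ ∣ ⊓ ∣ E₂ ∣)
      S = + s
      split : ∀ u → χ* u * solutions u ≤ 𝟙 (not (does (u ≟ 0F)) ∧ does (s ℕ.≤? ∣ Y u ∣)) * (M - S) + S * χ* u
      split u with u ≟ 0F
      ... | yes _ = ≤-reflexive (sym (trans (+-identityˡ (S * 0ℤ)) (*-zeroʳ S)))
      ... | no u≢0 with s ℕ.≤ᵇ ∣ Y u ∣ in s≤ᵇ
      ...   | true  = ≤-trans (≤-reflexive (*-identityˡ (solutions u))) (≤-trans (solutions-≤ u≢0) (≤-reflexive (m≡ M S)))
        where
        m≡ : ∀ M S → M ≡ 1ℤ * (M - S) + S * 1ℤ
        m≡ = solve-∀
      ...   | false = ≤-trans (≤-reflexive (trans (*-identityˡ (solutions u)) (sym (∣Y∣ u))))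
                              (≤-trans (+≤+ (ℕ.<⇒≤ (ℕ.≰⇒> s≰))) (≤-reflexive (s≡ M S)))
        where
        s≰ : ¬ s ℕ.≤ ∣ Y u ∣
        s≰ s≤ = subst Bool.T s≤ᵇ (ℕ.≤⇒≤ᵇ s≤)
        s≡ : ∀ M S → S ≡ 0ℤ * (M - S) + S * 1ℤ
        s≡ = solve-∀

open import Data.Nat using (ℕ; _*_; _<_; _≤_; _⊓_)
open import Data.Nat.Properties using (<⇒≤)
open import Data.Fin.Subset.Properties using (∣p∣≤n)
open import Function using (_∘_)
open Arithmetic using (deviation⇒positive; deviation⇒Bound53)

theorem5p3 : (F : FiniteField) → let open FiniteField F in
    (E₁ E₂ : Subset q) →
    (6 * q < ∣ E₁ ∣ * ∣ E₂ ∣ →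
      ∃ λ u → ∃ λ y → y ≢ 0F × (u +F y) ∈ E₁ × (u *F y) ∈ E₂)
    ×
    ((s : ℕ) → s < ∣ E₁ ∣ ⊓ ∣ E₂ ∣ →
      Σ (Subset q) λ D →
        (∀ u → u ∈ D → u ≢ 0F)
        × Bound53 q (∣ E₁ ∣) (∣ E₂ ∣) s (∣ D ∣)
        × (∀ u → u ∈ D →
             Σ (Subset q) λ Y → s ≤ ∣ Y ∣
               × (∀ y → y ∈ Y → (u +F y) ∈ E₁ × (u *F y) ∈ E₂)))
theorem5p3 F E₁ E₂ =
  (λ 6q<ab → witness (deviation⇒positive (∣p∣≤n E₁) (∣p∣≤n E₂) 6q<ab N-nonNeg deviation)) ,
  (λ s s<m → D s , (λ u → proj₁ ∘ ∈-D s) ,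
     deviation⇒Bound53 {d = ∣ D s ∣} 2≤q (∣p∣≤n E₁) (<⇒≤ s<m) deviation (N-≤ s (<⇒≤ s<m)) ,
     (λ u u∈D → Y u , proj₂ (∈-D s u∈D) , λ y → ∈-Y))
  where
  open Counting F E₁ E₂
  open FieldLemmas F using (2≤q)
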